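{- Let $q\ge2$ be an integer, $\theta_1,\dots,\theta_{q-1}\in\{0,1\}$, let $(\theta_n)_{n\ge0}$ be the $(0,\theta_1,\cdots,\theta_{q-1})$-Thue-Morse sequence, $\delta_n:=(-1)^{\theta_n}$, and $\Delta_0:=0$, $\Delta_n:=\delta_0+\delta_1+\cdots+\delta_{n-1}$ for $n\ge1$. (1) For all $k,s\in\mathbb{N}_0$ and $t\in\{0,1,\cdots,q^k-1\}$ we have $\delta_{sq^k+t}=\delta_s\delta_t$ and $\Delta_{sq^k+t}=\Delta_s\Delta_{q^k}+\delta_s\Delta_t$. (2) With the convention $0^0:=1$, for all $k\in\mathbb{N}_0$ we have $\Delta_{q^k}=\Delta_q^k$, $$\max\Big\{|\Delta_{q^k}|:(\delta_1,\cdots,\delta_{q-1})\in\{+1,-1\}^{q-1}\setminus\{(+1)^{q-1}\}\Big\}=(q-2)^k,$$ $$\max\Big\{|\Delta_n|:0\le n\le q^k,\ (\delta_1,\cdots,\delta_{q-1})\in\{+1,-1\}^{q-1}\setminus\{(+1)^{q-1}\}\Big\}=1+(q-2)+\cdots+(q-2)^k,$$ where the maxima range over all choices of $(\theta_1,\dots,\theta_{q-1})$ giving the indicated $(\delta_1,\dots,\delta_{q-1})$. (3) If $(\delta_1,\cdots,\delta_{q-1})\neq(+1)^{q-1}$, then $|\Delta_n|\le n^{\log_q(q-1)}$ for all $n$ large enough.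
   Context: For an integer $q\ge2$ and $\theta_1,\dots,\theta_{q-1}\in\{0,1\}$, the $(0,\theta_1,\cdots,\theta_{q-1})$-Thue-Morse sequence $(\theta_n)_{n\ge0}$ is the unique fixed point of the morphism on $\{0,1\}$ given by $0\mapsto0\theta_1\cdots\theta_{q-1}$, $1\mapsto1\overline{\theta}_1\cdots\overline{\theta}_{q-1}$, beginning with $\theta_0:=0$, where $\overline{0}:=1$ and $\overline{1}:=0$. $\mathbb{N}_0=\{0,1,2,\dots\}$. -}

module Defs where

open import Data.Bool using (Bool; true; false; _xor_; if_then_else_)
open import Data.Nat using (ℕ; zero; suc; _+_; _^_)
open import Data.Nat.DivMod using (_/_; _%_)
open import Data.Integer using (ℤ; +_; -_) renaming (_+_ to _+ℤ_)
open import Data.Vec using (Vec; []; _∷_)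

-- Throughout, the base is q = 2 + m  (so q ≥ 2 and q - 2 = m), and the
-- parameters (θ₁, …, θ_{q-1}) are given as a vector θs : Vec Bool (suc m),
-- with false = 0 and true = 1.

-- j-th entry of a vector (0-indexed), false if out of range (never used so).
nthOr : ∀ {k} → ℕ → Vec Bool k → Bool
nthOr _       []       = false
nthOr zero    (b ∷ bs) = b
nthOr (suc j) (b ∷ bs) = nthOr j bs

-- letter θs t = θ_t for 0 ≤ t ≤ q-1, with θ_0 = 0.
letter : ∀ {k} → Vec Bool k → ℕ → Bool
letter θs zero    = false
letter θs (suc j) = nthOr j θs

-- The fixed point x of 0 ↦ 0θ₁⋯θ_{q-1}, 1 ↦ 1θ̄₁⋯θ̄_{q-1} starting with 0 is
-- characterised by x_0 = 0 and x_{sq+t} = (σ(x_s))_t = x_s xor θ_t (0 ≤ t < q).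
-- We compute it by this recursion (on n ↦ n / q), with fuel n (enough as q ≥ 2).
tmAux : (m : ℕ) → Vec Bool (suc m) → ℕ → ℕ → Bool
tmAux m θs zero    _       = false
tmAux m θs (suc f) zero    = false
tmAux m θs (suc f) (suc n) =
  tmAux m θs f (suc n / (2 + m)) xor letter θs (suc n % (2 + m))

tm : (m : ℕ) → Vec Bool (suc m) → ℕ → Bool
tm m θs n = tmAux m θs n n

δ : (m : ℕ) → Vec Bool (suc m) → ℕ → ℤ
δ m θs n = if tm m θs n then - (+ 1) else + 1

Δ : (m : ℕ) → Vec Bool (suc m) → ℕ → ℤ
Δ m θs zero    = + 0
Δ m θs (suc n) = Δ m θs n +ℤ δ m θs n

geomSum : ℕ → ℕ → ℕ
geomSum r zero    = 1
geomSum r (suc k) = geomSum r k + r ^ suc k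

-- Since the morphism acts digitwise, θ_{sq+t} = θ_s ⊕ θ_t for t < q; iterating gives
-- θ_{sq^k+t} = θ_s ⊕ θ_t for t < q^k, and summing δ over the block [sq^k, sq^k + t) gives
-- both identities of (1), hence Δ_{q^k} = Δ_q^k.  If some θ_{1+i} = 1, the terms δ_0 = 1
-- and δ_{1+i} = -1 cancel in Δ_q, so |Δ_q| ≤ q - 2 = m; θ = (0,…,0,1) attains this.
-- For 0 < n ≤ q^{k+1} write n = sq + t with 0 < t ≤ q and s < q^k; then
--   Δ_n = Δ_s x + Δ_{s+1} y,   x = Δ_q - Δ_t,  y = Δ_t,   |x| + |y| ≤ q,
-- and |Δ_s|, |Δ_{s+1}| ≤ G := 1 + m + ⋯ + m^k by induction.  If x, y have the same
-- sign this is at most G|Δ_q| ≤ Gm; otherwise it is at most G|x + y| + min(|x|, |y|),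
-- and the cancellation |x + y| + 2 min(|x|, |y|) = |x| + |y| ≤ m + 2 bounds that by
-- Gm + 1 = 1 + m + ⋯ + m^{k+1}.
-- Finally 1 + m + ⋯ + m^{k+1} ≤ (m + 1)^k for large k, so for q^k ≤ n < q^{k+1} we get
-- |Δ_n|^b ≤ (m + 1)^{kb} ≤ q^{ka} ≤ n^a whenever (m + 1)^b ≤ q^a.

{-# OPTIONS --safe #-}
module Submission where

open import Defs
open import Data.Bool using (Bool; false)
open import Data.Nat using (ℕ; suc; _+_; _*_; _^_; _≤_; _<_)
open import Data.Integer using (ℤ; ∣_∣) renaming (_*_ to _*ℤ_; _+_ to _+ℤ_; _^_ to _^ℤ_)
open import Data.Vec using (Vec; replicate)
open import Data.Product using (_×_; Σ; ∃; ∃-syntax)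
open import Relation.Binary.PropositionalEquality using (_≡_; _≢_)

open import Data.Bool using (true; _xor_; if_then_else_)
open import Data.Bool.Properties using (xor-assoc; xor-identityʳ)
open import Data.Integer using (+_; -[1+_]; -_; _⊖_) renaming (_-_ to _-ℤ_)
import Data.Integer.Properties as ℤₚ
import Data.Integer.Tactic.RingSolver as ℤ-Solver
open import Data.Nat using (zero; z≤n; s≤s; _∸_; _<?_; _≤′_; ≤′-refl; ≤′-step; NonZero; >-nonZero; z<s)
open import Data.Nat.Properties
open import Algebra.Properties.CommutativeSemigroup *-commutativeSemigroup using (x∙yz≈y∙xz)
open import Data.Nat.DivMod
open import Data.Nat.Divisibility using (divides-refl)
import Data.Nat.Tactic.RingSolver as ℕ-Solver
open import Data.Vec using ([]; _∷_; tail)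
open import Data.Product using (_,_)
open import Data.Sum using (_⊎_; inj₁; inj₂)
open import Relation.Nullary using (yes; no; contradiction)
open import Function using (_∘_)
open import Relation.Binary.PropositionalEquality
  using (refl; sym; trans; cong; cong₂; subst; module ≡-Reasoning)

sign : Bool → ℤ
sign b = if b then - (+ 1) else + 1

sign-xor : ∀ a b → sign (a xor b) ≡ sign a *ℤ sign b
sign-xor true  true  = refl
sign-xor true  false = refl
sign-xor false true  = refl
sign-xor false false = refl

∣sign∣≡1 : ∀ b → ∣ sign b ∣ ≡ 1
∣sign∣≡1 true  = refl
∣sign∣≡1 false = refl

pos-^ : ∀ a k → + (a ^ k) ≡ (+ a) ^ℤ k
pos-^ a zero    = refl
pos-^ a (suc k) = trans (ℤₚ.pos-* a (a ^ k)) (cong (+ a *ℤ_) (pos-^ a k))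

∣i^n∣≡∣i∣^n : ∀ i n → ∣ i ^ℤ n ∣ ≡ ∣ i ∣ ^ n
∣i^n∣≡∣i∣^n i zero    = refl
∣i^n∣≡∣i∣^n i (suc n) = trans (ℤₚ.∣i*j∣≡∣i∣*∣j∣ i (i ^ℤ n)) (cong (∣ i ∣ *_) (∣i^n∣≡∣i∣^n i n))

[n∸m]+2*m≡m+n : ∀ {m n} → m ≤ n → (n ∸ m) + 2 * m ≡ m + n
[n∸m]+2*m≡m+n {m} {n} m≤n = begin
  (n ∸ m) + 2 * m       ≡⟨ regroup (n ∸ m) m ⟩
  ((n ∸ m) + m) + m     ≡⟨ cong (_+ m) (m∸n+n≡m m≤n) ⟩
  n + m                 ≡⟨ +-comm n m ⟩
  m + n                 ∎
  where
  open ≡-Reasoning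
  regroup : ∀ a b → a + 2 * b ≡ (a + b) + b
  regroup = ℕ-Solver.solve-∀

∣m⊖n∣-cases : ∀ m n → (∣ m ⊖ n ∣ + 2 * m ≡ m + n) ⊎ (∣ m ⊖ n ∣ + 2 * n ≡ m + n)
∣m⊖n∣-cases m n with ≤-total m n
... | inj₁ m≤n = inj₁ (trans (cong (_+ 2 * m) (ℤₚ.∣⊖∣-≤ m≤n)) ([n∸m]+2*m≡m+n m≤n))
... | inj₂ n≤m = inj₂ (begin
  ∣ m ⊖ n ∣ + 2 * n  ≡⟨ cong (_+ 2 * n) (trans (ℤₚ.∣m⊖n∣≡∣n⊖m∣ m n) (ℤₚ.∣⊖∣-≤ n≤m)) ⟩
  (m ∸ n) + 2 * n    ≡⟨ [n∸m]+2*m≡m+n n≤m ⟩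
  n + m              ≡⟨ +-comm n m ⟩
  m + n              ∎)
  where open ≡-Reasoning

∣i+j∣-cases : ∀ i j → (∣ i +ℤ j ∣ ≡ ∣ i ∣ + ∣ j ∣)
  ⊎ (∣ i +ℤ j ∣ + 2 * ∣ i ∣ ≡ ∣ i ∣ + ∣ j ∣)
  ⊎ (∣ i +ℤ j ∣ + 2 * ∣ j ∣ ≡ ∣ i ∣ + ∣ j ∣)
∣i+j∣-cases (+ m)    (+ n)    = inj₁ refl
∣i+j∣-cases -[1+ m ] -[1+ n ] = inj₁ (cong suc (sym (+-suc m n)))
∣i+j∣-cases (+ m)    -[1+ n ] = inj₂ (∣m⊖n∣-cases m (suc n))
∣i+j∣-cases -[1+ m ] (+ n) rewrite ℤₚ.∣m⊖n∣≡∣n⊖m∣ n (suc m) = inj₂ (∣m⊖n∣-cases (suc m) n)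

∣a*u+e*c∣≤G*∣u∣+∣c∣ : ∀ {G} a e u c → ∣ a ∣ ≤ G → ∣ e ∣ ≤ 1 →
  ∣ a *ℤ u +ℤ e *ℤ c ∣ ≤ G * ∣ u ∣ + ∣ c ∣
∣a*u+e*c∣≤G*∣u∣+∣c∣ {G} a e u c ∣a∣≤G ∣e∣≤1 = begin
  ∣ a *ℤ u +ℤ e *ℤ c ∣        ≤⟨ ℤₚ.∣i+j∣≤∣i∣+∣j∣ (a *ℤ u) (e *ℤ c) ⟩
  ∣ a *ℤ u ∣ + ∣ e *ℤ c ∣     ≡⟨ cong₂ _+_ (ℤₚ.∣i*j∣≡∣i∣*∣j∣ a u) (ℤₚ.∣i*j∣≡∣i∣*∣j∣ e c) ⟩
  ∣ a ∣ * ∣ u ∣ + ∣ e ∣ * ∣ c ∣ ≤⟨ +-mono-≤ (*-monoˡ-≤ ∣ u ∣ ∣a∣≤G) (*-monoˡ-≤ ∣ c ∣ ∣e∣≤1) ⟩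
  G * ∣ u ∣ + 1 * ∣ c ∣       ≡⟨ cong (_+_ (G * ∣ u ∣)) (*-identityˡ ∣ c ∣) ⟩
  G * ∣ u ∣ + ∣ c ∣           ∎
  where open ≤-Reasoning

G*u+c≤G*M+1 : ∀ {G u c M} → 1 ≤ G → u ≤ M → u + 2 * c ≤ 2 + M → G * u + c ≤ G * M + 1
G*u+c≤G*M+1 {G} {u} {zero} {M} _ u≤M _ = begin
  G * u + 0  ≡⟨ +-identityʳ (G * u) ⟩
  G * u      ≤⟨ *-monoʳ-≤ G u≤M ⟩
  G * M      ≤⟨ m≤m+n (G * M) 1 ⟩
  G * M + 1  ∎
  where open ≤-Reasoning
G*u+c≤G*M+1 {G} {u} {suc c} {M} 1≤G _ u+2c≤2+M = begin
  G * u + suc c             ≤⟨ +-monoʳ-≤ (G * u) (s≤s c≤G*2c) ⟩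
  G * u + suc (G * (2 * c)) ≡⟨ distrib G u c ⟩
  G * (u + 2 * c) + 1       ≤⟨ +-monoˡ-≤ 1 (*-monoʳ-≤ G u+2c≤M) ⟩
  G * M + 1                 ∎
  where
  open ≤-Reasoning
  distrib : ∀ G u c → G * u + suc (G * (2 * c)) ≡ G * (u + 2 * c) + 1
  distrib = ℕ-Solver.solve-∀
  c≤G*2c : c ≤ G * (2 * c)
  c≤G*2c = ≤-trans (m≤m+n c (c + 0)) (m≤n*m (2 * c) G {{>-nonZero 1≤G}})
  +-suc-twice : ∀ u c → u + 2 * suc c ≡ 2 + (u + 2 * c)
  +-suc-twice = ℕ-Solver.solve-∀
  u+2c≤M : u + 2 * c ≤ M
  u+2c≤M = +-cancelˡ-≤ 2 _ _ (subst (_≤ 2 + M) (+-suc-twice u c) u+2c≤2+M)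

∣a*x+[a+e]*y∣≤G*M+1 : ∀ {G M} a e x y → 1 ≤ G → ∣ e ∣ ≤ 1 → ∣ a ∣ ≤ G → ∣ a +ℤ e ∣ ≤ G →
  ∣ x +ℤ y ∣ ≤ M → ∣ x ∣ + ∣ y ∣ ≤ 2 + M → ∣ a *ℤ x +ℤ (a +ℤ e) *ℤ y ∣ ≤ G * M + 1
∣a*x+[a+e]*y∣≤G*M+1 {G} {M} a e x y 1≤G ∣e∣≤1 ∣a∣≤G ∣a+e∣≤G ∣x+y∣≤M ∣x∣+∣y∣≤2+M
  with ∣i+j∣-cases x y
... | inj₁ same-sign = begin
  ∣ a *ℤ x +ℤ (a +ℤ e) *ℤ y ∣                ≤⟨ ℤₚ.∣i+j∣≤∣i∣+∣j∣ (a *ℤ x) ((a +ℤ e) *ℤ y) ⟩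
  ∣ a *ℤ x ∣ + ∣ (a +ℤ e) *ℤ y ∣             ≡⟨ cong₂ _+_ (ℤₚ.∣i*j∣≡∣i∣*∣j∣ a x) (ℤₚ.∣i*j∣≡∣i∣*∣j∣ (a +ℤ e) y) ⟩
  ∣ a ∣ * ∣ x ∣ + ∣ a +ℤ e ∣ * ∣ y ∣         ≤⟨ +-mono-≤ (*-monoˡ-≤ ∣ x ∣ ∣a∣≤G) (*-monoˡ-≤ ∣ y ∣ ∣a+e∣≤G) ⟩
  G * ∣ x ∣ + G * ∣ y ∣                      ≡⟨ sym (*-distribˡ-+ G ∣ x ∣ ∣ y ∣) ⟩
  G * (∣ x ∣ + ∣ y ∣)                        ≡⟨ cong (G *_) (sym same-sign) ⟩
  G * ∣ x +ℤ y ∣                             ≤⟨ *-monoʳ-≤ G ∣x+y∣≤M ⟩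
  G * M                                      ≤⟨ m≤m+n (G * M) 1 ⟩
  G * M + 1                                  ∎
  where open ≤-Reasoning
... | inj₂ (inj₁ x-cancels) = begin
  ∣ a *ℤ x +ℤ (a +ℤ e) *ℤ y ∣                ≡⟨ cong ∣_∣ (regroup a e x y) ⟩
  ∣ (a +ℤ e) *ℤ (x +ℤ y) +ℤ (- e) *ℤ x ∣     ≤⟨ ∣a*u+e*c∣≤G*∣u∣+∣c∣ (a +ℤ e) (- e) (x +ℤ y) x ∣a+e∣≤G ∣-e∣≤1 ⟩
  G * ∣ x +ℤ y ∣ + ∣ x ∣                     ≤⟨ G*u+c≤G*M+1 1≤G ∣x+y∣≤M (≤-trans (≤-reflexive x-cancels) ∣x∣+∣y∣≤2+M) ⟩
  G * M + 1                                  ∎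
  where
  open ≤-Reasoning
  regroup : ∀ a e x y → a *ℤ x +ℤ (a +ℤ e) *ℤ y ≡ (a +ℤ e) *ℤ (x +ℤ y) +ℤ (- e) *ℤ x
  regroup = ℤ-Solver.solve-∀
  ∣-e∣≤1 : ∣ - e ∣ ≤ 1
  ∣-e∣≤1 = subst (_≤ 1) (sym (ℤₚ.∣-i∣≡∣i∣ e)) ∣e∣≤1
... | inj₂ (inj₂ y-cancels) = begin
  ∣ a *ℤ x +ℤ (a +ℤ e) *ℤ y ∣                ≡⟨ cong ∣_∣ (regroup a e x y) ⟩
  ∣ a *ℤ (x +ℤ y) +ℤ e *ℤ y ∣                ≤⟨ ∣a*u+e*c∣≤G*∣u∣+∣c∣ a e (x +ℤ y) y ∣a∣≤G ∣e∣≤1 ⟩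
  G * ∣ x +ℤ y ∣ + ∣ y ∣                     ≤⟨ G*u+c≤G*M+1 1≤G ∣x+y∣≤M (≤-trans (≤-reflexive y-cancels) ∣x∣+∣y∣≤2+M) ⟩
  G * M + 1                                  ∎
  where
  open ≤-Reasoning
  regroup : ∀ a e x y → a *ℤ x +ℤ (a +ℤ e) *ℤ y ≡ a *ℤ (x +ℤ y) +ℤ e *ℤ y
  regroup = ℤ-Solver.solve-∀

geomSum-suc : ∀ r k → geomSum r (suc k) ≡ geomSum r k * r + 1
geomSum-suc r zero    = horner r
  where
  horner : ∀ r → 1 + r * 1 ≡ 1 * r + 1
  horner = ℕ-Solver.solve-∀
geomSum-suc r (suc k) = begin
  geomSum r (suc k) + r ^ suc (suc k)       ≡⟨ cong (_+ r ^ suc (suc k)) (geomSum-suc r k) ⟩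
  geomSum r k * r + 1 + r * r ^ suc k       ≡⟨ horner r (geomSum r k) (r ^ suc k) ⟩
  (geomSum r k + r ^ suc k) * r + 1         ∎
  where
  open ≡-Reasoning
  horner : ∀ r g p → g * r + 1 + r * p ≡ (g + p) * r + 1
  horner = ℕ-Solver.solve-∀

1≤geomSum : ∀ r k → 1 ≤ geomSum r k
1≤geomSum r zero    = ≤-refl
1≤geomSum r (suc k) = ≤-trans (1≤geomSum r k) (m≤m+n (geomSum r k) (r ^ suc k))

geomSum+1≤2*r^k : ∀ {r} → 2 ≤ r → ∀ k → geomSum r k + 1 ≤ 2 * r ^ k
geomSum+1≤2*r^k 2≤r zero    = ≤-refl
geomSum+1≤2*r^k {r} 2≤r (suc k) = begin
  geomSum r (suc k) + 1     ≡⟨ cong (_+ 1) (geomSum-suc r k) ⟩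
  geomSum r k * r + 1 + 1   ≡⟨ +-assoc (geomSum r k * r) 1 1 ⟩
  geomSum r k * r + 2       ≤⟨ +-monoʳ-≤ (geomSum r k * r) 2≤r ⟩
  geomSum r k * r + r       ≡⟨ cong (_+_ (geomSum r k * r)) (sym (*-identityˡ r)) ⟩
  geomSum r k * r + 1 * r   ≡⟨ sym (*-distribʳ-+ r (geomSum r k) 1) ⟩
  (geomSum r k + 1) * r     ≤⟨ *-monoˡ-≤ r (geomSum+1≤2*r^k 2≤r k) ⟩
  2 * r ^ k * r             ≡⟨ rearrange (r ^ k) r ⟩
  2 * (r * r ^ k)           ∎
  where
  open ≤-Reasoning
  rearrange : ∀ p r → 2 * p * r ≡ 2 * (r * p)
  rearrange = ℕ-Solver.solve-∀

bernoulli : ∀ r j → r ^ j * (r + j) ≤ r * (1 + r) ^ j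
bernoulli r zero    = ≤-reflexive (trans (*-identityˡ (r + 0)) (trans (+-identityʳ r) (sym (*-identityʳ r))))
bernoulli r (suc j) = begin
  r * p * (r + suc j)            ≤⟨ m≤m+n (r * p * (r + suc j)) (p * j) ⟩
  r * p * (r + suc j) + p * j    ≡⟨ expand r p j ⟩
  (1 + r) * (p * (r + j))        ≤⟨ *-monoʳ-≤ (1 + r) (bernoulli r j) ⟩
  (1 + r) * (r * (1 + r) ^ j)    ≡⟨ x∙yz≈y∙xz (1 + r) r ((1 + r) ^ j) ⟩
  r * (1 + r) ^ suc j            ∎
  where
  open ≤-Reasoning
  p = r ^ j
  expand : ∀ r p j → r * p * (r + suc j) + p * j ≡ (1 + r) * (p * (r + j))
  expand = ℕ-Solver.solve-∀

-- Bernoulli: (1 + 1/r)^K ≥ 1 + K/r ≥ 2r for K = 2r².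
2*r^[1+K]≤[1+r]^K : ∀ r .{{_ : NonZero r}} → let K = 2 * r * r in 2 * r ^ suc K ≤ (1 + r) ^ K
2*r^[1+K]≤[1+r]^K r = *-cancelˡ-≤ r (begin
  r * (2 * r ^ suc K)   ≡⟨ rearrange r (r ^ K) ⟩
  r ^ K * K             ≤⟨ *-monoʳ-≤ (r ^ K) (m≤n+m K r) ⟩
  r ^ K * (r + K)       ≤⟨ bernoulli r K ⟩
  r * (1 + r) ^ K       ∎)
  where
  open ≤-Reasoning
  K = 2 * r * r
  rearrange : ∀ r p → r * (2 * (r * p)) ≡ p * (2 * r * r)
  rearrange = ℕ-Solver.solve-∀

∃-geomSum≤[1+r]^K : ∀ r → ∃[ K ] geomSum r (suc K) ≤ (1 + r) ^ K
∃-geomSum≤[1+r]^K zero          = 0 , ≤-refl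
∃-geomSum≤[1+r]^K (suc zero)    = 2 , ≤-refl
∃-geomSum≤[1+r]^K r@(suc (suc _)) = K , <⇒≤ (begin-strict
  geomSum r (suc K)       <⟨ m<m+n (geomSum r (suc K)) z<s ⟩
  geomSum r (suc K) + 1   ≤⟨ geomSum+1≤2*r^k (s≤s (s≤s z≤n)) (suc K) ⟩
  2 * r ^ suc K           ≤⟨ 2*r^[1+K]≤[1+r]^K r ⟩
  (1 + r) ^ K             ∎)
  where
  open ≤-Reasoning
  K = 2 * r * r

geomSum≤[1+r]^k-step : ∀ r k → geomSum r (suc k) ≤ (1 + r) ^ k →
  geomSum r (suc (suc k)) ≤ (1 + r) ^ suc k
geomSum≤[1+r]^k-step r k h = begin
  geomSum r (suc (suc k))          ≡⟨ geomSum-suc r (suc k) ⟩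
  geomSum r (suc k) * r + 1        ≤⟨ +-mono-≤ (*-monoˡ-≤ r h) (m^n>0 (1 + r) k) ⟩
  (1 + r) ^ k * r + (1 + r) ^ k    ≡⟨ +-comm ((1 + r) ^ k * r) ((1 + r) ^ k) ⟩
  (1 + r) ^ k + (1 + r) ^ k * r    ≡⟨ cong (_+_ ((1 + r) ^ k)) (*-comm ((1 + r) ^ k) r) ⟩
  (1 + r) ^ suc k                  ∎
  where open ≤-Reasoning

geomSum≤[1+r]^k-mono : ∀ r {K k} → geomSum r (suc K) ≤ (1 + r) ^ K → K ≤′ k →
  geomSum r (suc k) ≤ (1 + r) ^ k
geomSum≤[1+r]^k-mono r h ≤′-refl            = h
geomSum≤[1+r]^k-mono r h (≤′-step {k} K≤′k) = geomSum≤[1+r]^k-step r k (geomSum≤[1+r]^k-mono r h K≤′k)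

n<b^n : ∀ {b} → 1 < b → ∀ n → n < b ^ n
n<b^n 1<b zero          = z<s
n<b^n {b} 1<b (suc n)   = ≤-<-trans (n<b^n 1<b n) (^-monoʳ-< b 1<b (n<1+n n))

∃-power-bracket : ∀ b {n} j → 1 ≤ n → n < b ^ j → ∃[ k ] (b ^ k ≤ n × n < b ^ suc k)
∃-power-bracket b zero    1≤n n<1 = contradiction 1≤n (<⇒≱ n<1)
∃-power-bracket b {n} (suc j) 1≤n n<b^[1+j] with n <? b ^ j
... | yes n<b^j = ∃-power-bracket b j 1≤n n<b^j
... | no  n≮b^j = j , ≮⇒≥ n≮b^j , n<b^[1+j]

∃-⌊log⌋ : ∀ {b K n} → 1 < b → b ^ K ≤ n → ∃[ k ] (K ≤ k × b ^ k ≤ n × n < b ^ suc k)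
∃-⌊log⌋ {b@(suc _)} {K} {n} 1<b b^K≤n
  with ∃-power-bracket b n (≤-trans (m^n>0 b K) b^K≤n) (n<b^n 1<b n)
... | k , b^k≤n , n<b^[1+k] = k , K≤k , b^k≤n , n<b^[1+k]
  where
  K≤k : K ≤ k
  K≤k = ≮⇒≥ λ k<K → <⇒≱ (≤-<-trans b^K≤n n<b^[1+k]) (^-monoʳ-≤ b k<K)

[m^n]^o≡[m^o]^n : ∀ m n o → (m ^ n) ^ o ≡ (m ^ o) ^ n
[m^n]^o≡[m^o]^n m n o = begin
  (m ^ n) ^ o   ≡⟨ ^-*-assoc m n o ⟩
  m ^ (n * o)   ≡⟨ cong (m ^_) (*-comm n o) ⟩
  m ^ (o * n)   ≡⟨ ^-*-assoc m o n ⟨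
  (m ^ o) ^ n   ∎
  where open ≡-Reasoning

^-≤-exchange : ∀ {x c d n} k a b → x ≤ c ^ k → c ^ b ≤ d ^ a → d ^ k ≤ n → x ^ b ≤ n ^ a
^-≤-exchange {x} {c} {d} {n} k a b x≤c^k c^b≤d^a d^k≤n = begin
  x ^ b         ≤⟨ ^-monoˡ-≤ b x≤c^k ⟩
  (c ^ k) ^ b   ≡⟨ [m^n]^o≡[m^o]^n c k b ⟩
  (c ^ b) ^ k   ≤⟨ ^-monoˡ-≤ k c^b≤d^a ⟩
  (d ^ a) ^ k   ≡⟨ [m^n]^o≡[m^o]^n d a k ⟩
  (d ^ k) ^ a   ≤⟨ ^-monoˡ-≤ a d^k≤n ⟩
  n ^ a         ∎
  where open ≤-Reasoning

∃-nthOr≡true : ∀ {n} (v : Vec Bool n) → v ≢ replicate n false → ∃[ i ] (i < n × nthOr i v ≡ true)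
∃-nthOr≡true []          v≢0 = contradiction refl v≢0
∃-nthOr≡true (true ∷ v)  _   = 0 , z<s , refl
∃-nthOr≡true (false ∷ v) v≢0 with ∃-nthOr≡true v (v≢0 ∘ cong (false ∷_))
... | i , i<n , vᵢ≡true = suc i , s≤s i<n , vᵢ≡true

[1+n]/b≤n : ∀ {b} .{{_ : NonZero b}} → 1 < b → ∀ n → suc n / b ≤ n
[1+n]/b≤n {b} 1<b n with m/n<m (suc n) b 1<b
... | s≤s [1+n]/b<1+n = [1+n]/b<1+n

[t+s*b]/b≡s : ∀ {b} .{{_ : NonZero b}} s t → t < b → (t + s * b) / b ≡ s
[t+s*b]/b≡s {b} s t t<b = begin
  (t + s * b) / b     ≡⟨ +-distrib-/-∣ʳ t (divides-refl s) ⟩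
  t / b + s * b / b   ≡⟨ cong₂ _+_ (m<n⇒m/n≡0 t<b) (m*n/n≡m s b) ⟩
  s                   ∎
  where open ≡-Reasoning

[t+s*b]%b≡t : ∀ {b} .{{_ : NonZero b}} s t → t < b → (t + s * b) % b ≡ t
[t+s*b]%b≡t {b} s t t<b = trans ([m+kn]%n≡m%n t s b) (m<n⇒m%n≡m t<b)

module ThueMorse (m : ℕ) (θs : Vec Bool (suc m)) where

  q : ℕ
  q = 2 + m

  1<q : 1 < q
  1<q = s≤s (s≤s z≤n)

  θ : ℕ → Bool
  θ = tm m θs

  δ′ : ℕ → ℤ
  δ′ = δ m θs

  Δ′ : ℕ → ℤ
  Δ′ = Δ m θs

  tmAux-fuel : ∀ f g n → n ≤ f → n ≤ g → tmAux m θs f n ≡ tmAux m θs g n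
  tmAux-fuel zero    zero    n       _         _         = refl
  tmAux-fuel zero    (suc g) zero    _         _         = refl
  tmAux-fuel (suc f) zero    zero    _         _         = refl
  tmAux-fuel (suc f) (suc g) zero    _         _         = refl
  tmAux-fuel (suc f) (suc g) (suc n) (s≤s n≤f) (s≤s n≤g) =
    cong (_xor letter θs (suc n % q))
      (tmAux-fuel f g (suc n / q) (≤-trans ([1+n]/b≤n 1<q n) n≤f) (≤-trans ([1+n]/b≤n 1<q n) n≤g))

  θ-unfold : ∀ n → θ n ≡ θ (n / q) xor letter θs (n % q)
  θ-unfold zero    = refl
  θ-unfold (suc n) =
    cong (_xor letter θs (suc n % q)) (tmAux-fuel n (suc n / q) (suc n / q) ([1+n]/b≤n 1<q n) ≤-refl)

  θ-digit : ∀ s t → t < q → θ (t + s * q) ≡ θ s xor letter θs t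
  θ-digit s t t<q = trans (θ-unfold (t + s * q))
    (cong₂ (λ s′ t′ → θ s′ xor letter θs t′) ([t+s*b]/b≡s s t t<q) ([t+s*b]%b≡t s t t<q))

  θ-letter : ∀ t → t < q → θ t ≡ letter θs t
  θ-letter t t<q = trans (cong θ (sym (+-identityʳ t))) (θ-digit 0 t t<q)

  θ-split : ∀ k s t → t < q ^ k → θ (s * q ^ k + t) ≡ θ s xor θ t
  θ-split zero s zero _ = begin
    θ (s * 1 + 0)   ≡⟨ cong θ (trans (+-identityʳ (s * 1)) (*-identityʳ s)) ⟩
    θ s             ≡⟨ xor-identityʳ (θ s) ⟨
    θ s xor false   ∎
    where open ≡-Reasoning
  θ-split zero s (suc t) (s≤s ())
  θ-split (suc k) s t t<q^[1+k] = begin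
    θ (s * (q * q ^ k) + t)                  ≡⟨ cong θ digits ⟩
    θ (t % q + (s * q ^ k + t / q) * q)      ≡⟨ θ-digit (s * q ^ k + t / q) (t % q) (m%n<n t q) ⟩
    θ (s * q ^ k + t / q) xor letter θs (t % q)
                                             ≡⟨ cong (_xor letter θs (t % q)) (θ-split k s (t / q) t/q<q^k) ⟩
    (θ s xor θ (t / q)) xor letter θs (t % q) ≡⟨ xor-assoc (θ s) (θ (t / q)) (letter θs (t % q)) ⟩
    θ s xor (θ (t / q) xor letter θs (t % q)) ≡⟨ cong (θ s xor_) (θ-unfold t) ⟨
    θ s xor θ t                              ∎
    where
    open ≡-Reasoning
    t/q<q^k : t / q < q ^ k
    t/q<q^k = m<n*o⇒m/o<n (subst (t <_) (*-comm q (q ^ k)) t<q^[1+k])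
    regroup : ∀ s q p r d → s * (q * p) + (r + d * q) ≡ r + (s * p + d) * q
    regroup = ℕ-Solver.solve-∀
    digits : s * (q * q ^ k) + t ≡ t % q + (s * q ^ k + t / q) * q
    digits = trans (cong (_+_ (s * (q * q ^ k))) (m≡m%n+[m/n]*n t q)) (regroup s q (q ^ k) (t % q) (t / q))

  δ-split : ∀ k s t → t < q ^ k → δ′ (s * q ^ k + t) ≡ δ′ s *ℤ δ′ t
  δ-split k s t t<q^k = trans (cong sign (θ-split k s t t<q^k)) (sign-xor (θ s) (θ t))

  Δ-block : ∀ k s t → t ≤ q ^ k → Δ′ (s * q ^ k + t) ≡ Δ′ (s * q ^ k) +ℤ δ′ s *ℤ Δ′ t
  Δ-block k s zero _ = begin
    Δ′ (s * q ^ k + 0)                    ≡⟨ cong Δ′ (+-identityʳ (s * q ^ k)) ⟩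
    Δ′ (s * q ^ k)                        ≡⟨ ℤₚ.+-identityʳ (Δ′ (s * q ^ k)) ⟨
    Δ′ (s * q ^ k) +ℤ + 0                 ≡⟨ cong (Δ′ (s * q ^ k) +ℤ_) (ℤₚ.*-zeroʳ (δ′ s)) ⟨
    Δ′ (s * q ^ k) +ℤ δ′ s *ℤ + 0         ∎
    where open ≡-Reasoning
  Δ-block k s (suc t) 1+t≤q^k = begin
    Δ′ (s * q ^ k + suc t)                              ≡⟨ cong Δ′ (+-suc (s * q ^ k) t) ⟩
    Δ′ (s * q ^ k + t) +ℤ δ′ (s * q ^ k + t)            ≡⟨ cong₂ _+ℤ_ (Δ-block k s t (<⇒≤ 1+t≤q^k)) (δ-split k s t 1+t≤q^k) ⟩
    Δ′ (s * q ^ k) +ℤ δ′ s *ℤ Δ′ t +ℤ δ′ s *ℤ δ′ t      ≡⟨ factor (Δ′ (s * q ^ k)) (δ′ s) (Δ′ t) (δ′ t) ⟩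
    Δ′ (s * q ^ k) +ℤ δ′ s *ℤ (Δ′ t +ℤ δ′ t)            ∎
    where
    open ≡-Reasoning
    factor : ∀ a e x y → a +ℤ e *ℤ x +ℤ e *ℤ y ≡ a +ℤ e *ℤ (x +ℤ y)
    factor = ℤ-Solver.solve-∀

  Δ-multiple : ∀ k s → Δ′ (s * q ^ k) ≡ Δ′ s *ℤ Δ′ (q ^ k)
  Δ-multiple k zero    = refl
  Δ-multiple k (suc s) = begin
    Δ′ (q ^ k + s * q ^ k)                          ≡⟨ cong Δ′ (+-comm (q ^ k) (s * q ^ k)) ⟩
    Δ′ (s * q ^ k + q ^ k)                          ≡⟨ Δ-block k s (q ^ k) ≤-refl ⟩
    Δ′ (s * q ^ k) +ℤ δ′ s *ℤ Δ′ (q ^ k)            ≡⟨ cong (_+ℤ δ′ s *ℤ Δ′ (q ^ k)) (Δ-multiple k s) ⟩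
    Δ′ s *ℤ Δ′ (q ^ k) +ℤ δ′ s *ℤ Δ′ (q ^ k)        ≡⟨ ℤₚ.*-distribʳ-+ (Δ′ (q ^ k)) (Δ′ s) (δ′ s) ⟨
    (Δ′ s +ℤ δ′ s) *ℤ Δ′ (q ^ k)                    ∎
    where open ≡-Reasoning

  Δ-split : ∀ k s t → t ≤ q ^ k → Δ′ (s * q ^ k + t) ≡ Δ′ s *ℤ Δ′ (q ^ k) +ℤ δ′ s *ℤ Δ′ t
  Δ-split k s t t≤q^k = trans (Δ-block k s t t≤q^k) (cong (_+ℤ δ′ s *ℤ Δ′ t) (Δ-multiple k s))

  Δ-pow : ∀ k → Δ′ (q ^ k) ≡ Δ′ q ^ℤ k
  Δ-pow zero    = refl
  Δ-pow (suc k) = trans (Δ-multiple k q) (cong (Δ′ q *ℤ_) (Δ-pow k))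

  Δ-interpolate : ∀ s t → t ≤ q → Δ′ (t + s * q) ≡ Δ′ s *ℤ (Δ′ q -ℤ Δ′ t) +ℤ (Δ′ s +ℤ δ′ s) *ℤ Δ′ t
  Δ-interpolate s t t≤q = begin
    Δ′ (t + s * q)                                       ≡⟨ cong Δ′ (trans (+-comm t (s * q)) (cong (λ p → s * p + t) (sym (*-identityʳ q)))) ⟩
    Δ′ (s * q ^ 1 + t)                                   ≡⟨ Δ-split 1 s t (subst (t ≤_) (sym (*-identityʳ q)) t≤q) ⟩
    Δ′ s *ℤ Δ′ (q * 1) +ℤ δ′ s *ℤ Δ′ t                   ≡⟨ cong (λ p → Δ′ s *ℤ Δ′ p +ℤ δ′ s *ℤ Δ′ t) (*-identityʳ q) ⟩
    Δ′ s *ℤ Δ′ q +ℤ δ′ s *ℤ Δ′ t                         ≡⟨ regroup (Δ′ s) (δ′ s) (Δ′ q) (Δ′ t) ⟩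
    Δ′ s *ℤ (Δ′ q -ℤ Δ′ t) +ℤ (Δ′ s +ℤ δ′ s) *ℤ Δ′ t     ∎
    where
    open ≡-Reasoning
    regroup : ∀ a e d y → a *ℤ d +ℤ e *ℤ y ≡ a *ℤ (d -ℤ y) +ℤ (a +ℤ e) *ℤ y
    regroup = ℤ-Solver.solve-∀

  ∣i+δ∣≤1+∣i∣ : ∀ i n → ∣ i +ℤ δ′ n ∣ ≤ suc ∣ i ∣
  ∣i+δ∣≤1+∣i∣ i n = begin
    ∣ i +ℤ δ′ n ∣          ≤⟨ ℤₚ.∣i+j∣≤∣i∣+∣j∣ i (δ′ n) ⟩
    (∣ i ∣ + ∣ δ′ n ∣)     ≡⟨ cong (_+_ ∣ i ∣) (∣sign∣≡1 (θ n)) ⟩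
    (∣ i ∣ + 1)            ≡⟨ +-comm ∣ i ∣ 1 ⟩
    suc ∣ i ∣              ∎
    where open ≤-Reasoning

  ∣Δ∣≤n : ∀ n → ∣ Δ′ n ∣ ≤ n
  ∣Δ∣≤n zero    = z≤n
  ∣Δ∣≤n (suc n) = ≤-trans (∣i+δ∣≤1+∣i∣ (Δ′ n) n) (s≤s (∣Δ∣≤n n))

  Δ-lipschitz : ∀ b j → ∣ Δ′ (b + j) -ℤ Δ′ b ∣ ≤ j
  Δ-lipschitz b zero rewrite +-identityʳ b | ℤₚ.+-inverseʳ (Δ′ b) = z≤n
  Δ-lipschitz b (suc j) rewrite +-suc b j =
    subst (_≤ suc j) (cong ∣_∣ (swap (Δ′ (b + j)) (δ′ (b + j)) (Δ′ b)))
      (≤-trans (∣i+δ∣≤1+∣i∣ (Δ′ (b + j) -ℤ Δ′ b) (b + j)) (s≤s (Δ-lipschitz b j)))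
    where
    swap : ∀ x d y → x -ℤ y +ℤ d ≡ x +ℤ d -ℤ y
    swap = ℤ-Solver.solve-∀

  ∣Δq∣≤m : θs ≢ replicate (suc m) false → ∣ Δ′ q ∣ ≤ m
  ∣Δq∣≤m θs≢0 with ∃-nthOr≡true θs θs≢0
  ... | i , s≤s i≤m , θsᵢ≡true = begin
    ∣ Δ′ q ∣                                ≡⟨ cong ∣_∣ telescope ⟩
    ∣ Δ′ (1 + i) -ℤ Δ′ 1 +ℤ (Δ′ (2 + i + (m ∸ i)) -ℤ Δ′ (2 + i)) ∣
                                            ≤⟨ ℤₚ.∣i+j∣≤∣i∣+∣j∣ (Δ′ (1 + i) -ℤ Δ′ 1) _ ⟩
    ∣ Δ′ (1 + i) -ℤ Δ′ 1 ∣ + ∣ Δ′ (2 + i + (m ∸ i)) -ℤ Δ′ (2 + i) ∣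
                                            ≤⟨ +-mono-≤ (Δ-lipschitz 1 i) (Δ-lipschitz (2 + i) (m ∸ i)) ⟩
    i + (m ∸ i)                             ≡⟨ m+[n∸m]≡n i≤m ⟩
    m                                       ∎
    where
    open ≤-Reasoning
    δ₁₊ᵢ≡-1 : δ′ (1 + i) ≡ - (+ 1)
    δ₁₊ᵢ≡-1 = cong sign (trans (θ-letter (1 + i) (s≤s (s≤s i≤m))) θsᵢ≡true)
    split : ∀ x y → x ≡ (y -ℤ + 1) +ℤ (x -ℤ (y +ℤ - (+ 1)))
    split = ℤ-Solver.solve-∀
    telescope : Δ′ q ≡ Δ′ (1 + i) -ℤ Δ′ 1 +ℤ (Δ′ (2 + i + (m ∸ i)) -ℤ Δ′ (2 + i))
    telescope = trans (cong (λ n → Δ′ (2 + n)) (sym (m+[n∸m]≡n i≤m)))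
      (trans (split (Δ′ (2 + i + (m ∸ i))) (Δ′ (1 + i)))
        (cong (λ d → Δ′ (1 + i) -ℤ + 1 +ℤ (Δ′ (2 + i + (m ∸ i)) -ℤ (Δ′ (1 + i) +ℤ d))) (sym δ₁₊ᵢ≡-1)))

  ∣Δ[q^k]∣≡∣Δq∣^k : ∀ k → ∣ Δ′ (q ^ k) ∣ ≡ ∣ Δ′ q ∣ ^ k
  ∣Δ[q^k]∣≡∣Δq∣^k k = trans (cong ∣_∣ (Δ-pow k)) (∣i^n∣≡∣i∣^n (Δ′ q) k)

  ∣Δ[q^k]∣≤m^k : θs ≢ replicate (suc m) false → ∀ k → ∣ Δ′ (q ^ k) ∣ ≤ m ^ k
  ∣Δ[q^k]∣≤m^k θs≢0 k = ≤-trans (≤-reflexive (∣Δ[q^k]∣≡∣Δq∣^k k)) (^-monoˡ-≤ k (∣Δq∣≤m θs≢0))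

  Δ-bound : θs ≢ replicate (suc m) false → ∀ k n → n ≤ q ^ k → ∣ Δ′ n ∣ ≤ geomSum m k
  Δ-bound θs≢0 zero    n       n≤1          = ≤-trans (∣Δ∣≤n n) n≤1
  Δ-bound θs≢0 (suc k) zero    _            = z≤n
  Δ-bound θs≢0 (suc k) (suc n) n<q^[1+k] = begin
    ∣ Δ′ (suc n) ∣                          ≡⟨ cong (λ n′ → ∣ Δ′ (suc n′) ∣) (m≡m%n+[m/n]*n n q) ⟩
    ∣ Δ′ (t + s * q) ∣                      ≡⟨ cong ∣_∣ (Δ-interpolate s t t≤q) ⟩
    ∣ Δ′ s *ℤ x +ℤ (Δ′ s +ℤ δ′ s) *ℤ y ∣    ≤⟨ ∣a*x+[a+e]*y∣≤G*M+1 (Δ′ s) (δ′ s) x y (1≤geomSum m k)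
                                                 (≤-reflexive (∣sign∣≡1 (θ s)))
                                                 (Δ-bound θs≢0 k s (<⇒≤ s<q^k)) (Δ-bound θs≢0 k (suc s) s<q^k)
                                                 ∣x+y∣≤m ∣x∣+∣y∣≤q ⟩
    geomSum m k * m + 1                     ≡⟨ geomSum-suc m k ⟨
    geomSum m (suc k)                       ∎
    where
    open ≤-Reasoning
    s t : ℕ
    s = n / q
    t = suc (n % q)
    x y : ℤ
    x = Δ′ q -ℤ Δ′ t
    y = Δ′ t
    t≤q : t ≤ q
    t≤q = m%n<n n q
    s<q^k : s < q ^ k
    s<q^k = m<n*o⇒m/o<n (subst (n <_) (*-comm q (q ^ k)) n<q^[1+k])
    [a-b]+b≡a : ∀ a b → a -ℤ b +ℤ b ≡ a
    [a-b]+b≡a = ℤ-Solver.solve-∀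
    ∣x+y∣≤m : ∣ x +ℤ y ∣ ≤ m
    ∣x+y∣≤m = subst (λ d → ∣ d ∣ ≤ m) (sym ([a-b]+b≡a (Δ′ q) (Δ′ t))) (∣Δq∣≤m θs≢0)
    ∣x∣≤q∸t : ∣ x ∣ ≤ q ∸ t
    ∣x∣≤q∸t = subst (λ n′ → ∣ Δ′ n′ -ℤ Δ′ t ∣ ≤ q ∸ t) (m+[n∸m]≡n t≤q) (Δ-lipschitz t (q ∸ t))
    ∣x∣+∣y∣≤q : ∣ x ∣ + ∣ y ∣ ≤ q
    ∣x∣+∣y∣≤q = ≤-trans (+-mono-≤ ∣x∣≤q∸t (∣Δ∣≤n t)) (≤-reflexive (m∸n+n≡m t≤q))

  ∣Δ∣-eventually≤[1+m]^k : θs ≢ replicate (suc m) false →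
    ∃[ K ] (∀ {k n} → K ≤ k → n < q ^ suc k → ∣ Δ′ n ∣ ≤ (1 + m) ^ k)
  ∣Δ∣-eventually≤[1+m]^k θs≢0 with ∃-geomSum≤[1+r]^K m
  ... | K , geomSum≤ = K , λ {k} {n} K≤k n<q^[1+k] →
    ≤-trans (Δ-bound θs≢0 (suc k) n (<⇒≤ n<q^[1+k])) (geomSum≤[1+r]^k-mono m geomSum≤ (≤⇒≤′ K≤k))

  ∣Δ∣^b≤n^a : θs ≢ replicate (suc m) false →
    ∃[ N ] ((n : ℕ) → N ≤ n → (a b : ℕ) → (1 + m) ^ b ≤ q ^ a → ∣ Δ′ n ∣ ^ b ≤ n ^ a)
  ∣Δ∣^b≤n^a θs≢0 with ∣Δ∣-eventually≤[1+m]^k θs≢0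
  ... | K , ∣Δ∣≤ = q ^ K , λ n q^K≤n a b [1+m]^b≤q^a →
    let k , K≤k , q^k≤n , n<q^[1+k] = ∃-⌊log⌋ 1<q q^K≤n
    in ^-≤-exchange k a b (∣Δ∣≤ K≤k n<q^[1+k]) [1+m]^b≤q^a q^k≤n

lastTrue : (m : ℕ) → Vec Bool (suc m)
lastTrue zero    = true ∷ []
lastTrue (suc m) = false ∷ lastTrue m

nthOr-lastTrue-< : ∀ m i → i < m → nthOr i (lastTrue m) ≡ false
nthOr-lastTrue-< (suc m) zero    _         = refl
nthOr-lastTrue-< (suc m) (suc i) (s≤s i<m) = nthOr-lastTrue-< m i i<m

nthOr-lastTrue-last : ∀ m → nthOr m (lastTrue m) ≡ true
nthOr-lastTrue-last zero    = refl
nthOr-lastTrue-last (suc m) = nthOr-lastTrue-last m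

lastTrue≢0 : ∀ m → lastTrue m ≢ replicate (suc m) false
lastTrue≢0 zero    ()
lastTrue≢0 (suc m) eq = lastTrue≢0 m (cong tail eq)

module Extremal (m : ℕ) where
  open ThueMorse m (lastTrue m)

  θ-ramp : ∀ t → t ≤ m → θ t ≡ false
  θ-ramp zero    _   = refl
  θ-ramp (suc t) t<m = trans (θ-letter (suc t) (s≤s (s≤s (<⇒≤ t<m)))) (nthOr-lastTrue-< m t t<m)

  Δ-ramp : ∀ t → t ≤ suc m → Δ′ t ≡ + t
  Δ-ramp zero    _         = refl
  Δ-ramp (suc t) (s≤s t≤m) =
    trans (cong₂ _+ℤ_ (Δ-ramp t (m≤n⇒m≤1+n t≤m)) (cong sign (θ-ramp t t≤m))) (cong +_ (+-comm t 1))

  Δq≡m : Δ′ q ≡ + m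
  Δq≡m = cong₂ _+ℤ_ (Δ-ramp (suc m) ≤-refl)
    (cong sign (trans (θ-letter (suc m) ≤-refl) (nthOr-lastTrue-last m)))

  Δ[q^k]≡m^k : ∀ k → Δ′ (q ^ k) ≡ + (m ^ k)
  Δ[q^k]≡m^k k = trans (Δ-pow k) (trans (cong (_^ℤ k) Δq≡m) (sym (pos-^ m k)))

  extremalIndex : ℕ → ℕ
  extremalIndex zero    = 1
  extremalIndex (suc k) = m * q ^ k + extremalIndex k

  extremalIndex≤q^k : ∀ k → extremalIndex k ≤ q ^ k
  extremalIndex≤q^k zero    = ≤-refl
  extremalIndex≤q^k (suc k) = begin
    m * q ^ k + extremalIndex k   ≤⟨ +-monoʳ-≤ (m * q ^ k) (extremalIndex≤q^k k) ⟩
    m * q ^ k + q ^ k             ≡⟨ +-comm (m * q ^ k) (q ^ k) ⟩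
    q ^ k + m * q ^ k             ≤⟨ m≤n+m (q ^ k + m * q ^ k) (q ^ k) ⟩
    q * q ^ k                     ∎
    where open ≤-Reasoning

  Δ-extremalIndex : ∀ k → Δ′ (extremalIndex k) ≡ + geomSum m k
  Δ-extremalIndex zero    = refl
  Δ-extremalIndex (suc k) = begin
    Δ′ (m * q ^ k + extremalIndex k)                      ≡⟨ Δ-split k m (extremalIndex k) (extremalIndex≤q^k k) ⟩
    Δ′ m *ℤ Δ′ (q ^ k) +ℤ δ′ m *ℤ Δ′ (extremalIndex k)    ≡⟨ cong₂ _+ℤ_ (cong₂ _*ℤ_ (Δ-ramp m (n≤1+n m)) (Δ[q^k]≡m^k k))
                                                               (cong₂ _*ℤ_ (cong sign (θ-ramp m ≤-refl)) (Δ-extremalIndex k)) ⟩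
    + m *ℤ + (m ^ k) +ℤ + 1 *ℤ + geomSum m k              ≡⟨ cong₂ _+ℤ_ (sym (ℤₚ.pos-* m (m ^ k))) (ℤₚ.*-identityˡ (+ geomSum m k)) ⟩
    + (m ^ suc k) +ℤ + geomSum m k                        ≡⟨ cong +_ (+-comm (m ^ suc k) (geomSum m k)) ⟩
    + geomSum m (suc k)                                   ∎
    where open ≡-Reasoning

open ThueMorse using (δ-split; Δ-split; Δ-pow; ∣Δ[q^k]∣≤m^k; Δ-bound; ∣Δ∣^b≤n^a)
open Extremal using (Δ[q^k]≡m^k; extremalIndex; extremalIndex≤q^k; Δ-extremalIndex)

proposition3p1 : (m : ℕ) →
    -- part (1)
    ((θs : Vec Bool (suc m)) → (k s t : ℕ) → t < (2 + m) ^ k →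
      (δ m θs (s * (2 + m) ^ k + t) ≡ δ m θs s *ℤ δ m θs t)
      × (Δ m θs (s * (2 + m) ^ k + t)
          ≡ Δ m θs s *ℤ Δ m θs ((2 + m) ^ k) +ℤ δ m θs s *ℤ Δ m θs t))
    -- part (2), first claim
    × ((θs : Vec Bool (suc m)) → (k : ℕ) →
        Δ m θs ((2 + m) ^ k) ≡ Δ m θs (2 + m) ^ℤ k)
    -- part (2), second claim: the maximum of |Δ_{q^k}| is (q-2)^k
    × ((k : ℕ) →
        (∃[ θs ] (θs ≢ replicate (suc m) false) × (∣ Δ m θs ((2 + m) ^ k) ∣ ≡ m ^ k))
        × ((θs : Vec Bool (suc m)) → θs ≢ replicate (suc m) false →
            ∣ Δ m θs ((2 + m) ^ k) ∣ ≤ m ^ k))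
    -- part (2), third claim: the maximum of |Δ_n|, 0 ≤ n ≤ q^k, is 1 + (q-2) + ⋯ + (q-2)^k
    × ((k : ℕ) →
        (∃[ θs ] ∃[ n ] (θs ≢ replicate (suc m) false) × (n ≤ (2 + m) ^ k)
            × (∣ Δ m θs n ∣ ≡ geomSum m k))
        × ((θs : Vec Bool (suc m)) → (n : ℕ) → θs ≢ replicate (suc m) false →
            n ≤ (2 + m) ^ k → ∣ Δ m θs n ∣ ≤ geomSum m k))
    -- part (3): |Δ_n| ≤ n^{log_q (q-1)} for all large n, where
    -- x ≤ n^{log_q(q-1)} is expressed as: for all a, b with b ≥ 1 and
    -- (q-1)^b ≤ q^a (i.e. a/b ≥ log_q(q-1)), x^b ≤ n^a.
    × ((θs : Vec Bool (suc m)) → θs ≢ replicate (suc m) false →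
        ∃[ N ] ((n : ℕ) → N ≤ n → (a b : ℕ) → 1 ≤ b →
          (1 + m) ^ b ≤ (2 + m) ^ a → ∣ Δ m θs n ∣ ^ b ≤ n ^ a))
proposition3p1 m =
    (λ θs k s t t<q^k → δ-split m θs k s t t<q^k , Δ-split m θs k s t (<⇒≤ t<q^k))
  , (λ θs → Δ-pow m θs)
  , (λ k → (lastTrue m , lastTrue≢0 m , cong ∣_∣ (Δ[q^k]≡m^k m k))
         , (λ θs θs≢0 → ∣Δ[q^k]∣≤m^k m θs θs≢0 k))
  , (λ k → (lastTrue m , extremalIndex m k , lastTrue≢0 m , extremalIndex≤q^k m k
             , cong ∣_∣ (Δ-extremalIndex m k))
         , (λ θs n θs≢0 → Δ-bound m θs θs≢0 k n))
  , λ θs θs≢0 → let N , ∣Δ∣^b≤ = ∣Δ∣^b≤n^a m θs θs≢0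
                in N , λ n N≤n a b _ → ∣Δ∣^b≤ n N≤n a b
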